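{- Let $p$ be a prime, let $H$ be a graph with vertex set $[m]$, and let $\lambda_1,\dots,\lambda_m$ be distinct elements of $\mathbb{F}_p$; write $\lambda_{ij} = \lambda_j - \lambda_i$. For each edge $\{i,j\}$ of $H$, let $G(ij)$ be the bipartite graph with parts $X_i = \mathbb{F}_p^2 \times \{i\}$ and $X_j = \mathbb{F}_p^2 \times\{j\}$ in which $(x,i)$ is adjacent to $(y,j)$ if and only if $y = x + \lambda_{ij}(a,a^2)$ for some $a \in \mathbb{F}_p^*$. If $\{h,i\}$ and $\{i,j\}$ are edges of $H$ with $h \neq j$, then the graph $G(hij) = G(hi) \cup G(ij)$ contains no subgraph isomorphic to $K_{2,3}$.
   Context: Scalar multiplication $\lambda(a,a^2)$ is componentwise in $\mathbb{F}_p^2$. The adjacency relation is symmetric in $i,j$ since $\lambda_{ji} = -\lambda_{ij}$. -}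

module Defs where

open import Data.Nat using (ℕ; _+_; _*_; _∸_; NonZero)
open import Data.Nat.DivMod using (_mod_)
open import Data.Fin using (Fin; toℕ)
open import Data.Product using (_×_; _,_; ∃; ∃-syntax)
open import Data.Sum using (_⊎_)
open import Relation.Binary.PropositionalEquality using (_≡_; _≢_)
open import Relation.Nullary using (¬_)

module Field (p : ℕ) .{{_ : NonZero p}} where
  F : Set
  F = Fin p

  _+F_ : F → F → F
  x +F y = (toℕ x + toℕ y) mod p

  _*F_ : F → F → F
  x *F y = (toℕ x * toℕ y) mod p

  _-F_ : F → F → F
  y -F x = (toℕ y + (p ∸ toℕ x)) mod p

  zeroF : F
  zeroF = 0 mod p

  F² : Set
  F² = F × F

  _+²_ : F² → F² → F²
  (x₁ , x₂) +² (y₁ , y₂) = (x₁ +F y₁ , x₂ +F y₂)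

  _·²_ : F → F² → F²
  c ·² (y₁ , y₂) = (c *F y₁ , c *F y₂)

  par : F → F²
  par a = (a , a *F a)

record Graph (m : ℕ) : Set₁ where
  field
    Adj     : Fin m → Fin m → Set
    symm    : ∀ {i j} → Adj i j → Adj j i
    irrefl  : ∀ {i} → ¬ Adj i i

module Construction (p : ℕ) .{{_ : NonZero p}} (m : ℕ) (λ′ : Fin m → Field.F p) where
  open Field p

  Vertex : Set
  Vertex = F² × Fin m

  lam : Fin m → Fin m → F
  lam i j = λ′ j -F λ′ i

  Step : F → F² → F² → Set
  Step c x y = ∃[ a ] (a ≢ zeroF × y ≡ x +² (c ·² par a))

  G : Fin m → Fin m → Vertex → Vertex → Set
  G i j (x , k) (y , l) =
      (k ≡ i × l ≡ j × Step (lam i j) x y)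
    ⊎ (k ≡ j × l ≡ i × Step (lam i j) y x)

  G₃ : Fin m → Fin m → Fin m → Vertex → Vertex → Set
  G₃ h i j u v = G h i u v ⊎ G i j u v

ContainsK23 : {V : Set} → (V → V → Set) → Set
ContainsK23 {V} E =
  ∃[ u₁ ] ∃[ u₂ ] ∃[ w₁ ] ∃[ w₂ ] ∃[ w₃ ]
    ( (u₁ ≢ u₂ × u₁ ≢ w₁ × u₁ ≢ w₂ × u₁ ≢ w₃ × u₂ ≢ w₁ × u₂ ≢ w₂ × u₂ ≢ w₃
       × w₁ ≢ w₂ × w₁ ≢ w₃ × w₂ ≢ w₃)
    × (E u₁ w₁ × E u₁ w₂ × E u₁ w₃ × E u₂ w₁ × E u₂ w₂ × E u₂ w₃) )

-- Reduced modulo p, an edge of G(hij) joins z ∈ Xᵢ to o ∈ Xₖ (k = h or j) with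
-- o = z + cₖ P(a), where P(a) = (a , a²), cₖ = λₖ - λᵢ ≠ 0 and a ≠ 0.  The secant of the
-- parabola through P(a) and P(a′) has direction (1 , a + a′), so two translates of one
-- chord, c (P(a) - P(a′)) = c (P(b) - P(b′)), force a = a′ or a = b: each G(ik) has no C₄.
-- If the pair of a K₂,₃ lies in Xᵢ, two of its three neighbours lie in the same Xₖ, giving a
-- C₄; so does a pair lying in one Xₖ.  A pair u₁ ∈ Xₕ, u₂ ∈ Xⱼ has a common neighbour
-- z = u₁ - cₕ P(a) = u₂ - cⱼ P(b) only when cₕ P(a) - cⱼ P(b) = u₁ - u₂; comparing two
-- solutions with a fixed one puts them on two lines meeting once, since cₕ ≠ cⱼ.

module Submission where

open import Defs
open import Data.Empty using (⊥; ⊥-elim)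
open import Data.Fin using (Fin; toℕ; _≟_)
open import Data.Fin.Properties using (toℕ-fromℕ<; toℕ-injective; toℕ<n)
open import Data.Integer using (ℤ; +_; _+_; _*_; _-_; -_; ∣_∣; _%ℕ_; _/ℕ_)
open import Data.Integer.DivMod using (a≡a%ℕn+[a/ℕn]*n; n%ℕd<d)
open import Data.Integer.Divisibility.Signed
  using (_∣_; divides; _∣?_; ∣-refl; ∣m∣n⇒∣m+n; ∣m⇒∣-m; ∣n⇒∣m*n; ∣m⇒∣m*n; ∣⇒∣ᵤ; ∣ᵤ⇒∣)
open import Data.Integer.Properties
  using (+-identityˡ; +-identityʳ; *-zeroʳ; abs-*; m-n≡m⊖n; ⊖-≥; pos-+; pos-*)
open import Data.Integer.Tactic.RingSolver using (solve)
open import Data.List using (_∷_; [])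
open import Data.Nat as ℕ using (ℕ; NonZero; zero; suc; _∸_)
open import Data.Nat.Base using (nonTrivial⇒n>1)
import Data.Nat.Divisibility as ℕ
open import Data.Nat.DivMod using (_mod_; m%n<n)
open import Data.Nat.Primality using (Prime; euclidsLemma; prime⇒nonTrivial)
import Data.Nat.Properties as ℕ
open import Data.Product using (_×_; _,_; proj₁; proj₂; zip′; uncurry′)
open import Data.Sum using (_⊎_; inj₁; inj₂; [_,_]; map; map₂)
open import Function using (id; _∘_)
open import Function.Definitions using (Injective)
open import Relation.Binary.Bundles using (Setoid)
open import Relation.Binary.Definitions using (Decidable)
open import Relation.Binary.PropositionalEquality
  using (_≡_; _≢_; refl; sym; trans; cong; cong₂; subst)
import Relation.Binary.Reasoning.Setoid
open import Relation.Nullary using (¬_; yes; no; map′; contradiction)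

pigeonhole : ∀ {A : Set} {x y a b c : A} → a ≡ x ⊎ a ≡ y → b ≡ x ⊎ b ≡ y → c ≡ x ⊎ c ≡ y
  → a ≡ b ⊎ a ≡ c ⊎ b ≡ c
pigeonhole (inj₁ refl) (inj₁ refl) _           = inj₁ refl
pigeonhole (inj₂ refl) (inj₂ refl) _           = inj₁ refl
pigeonhole (inj₁ refl) (inj₂ _)    (inj₁ refl) = inj₂ (inj₁ refl)
pigeonhole (inj₂ refl) (inj₁ _)    (inj₂ refl) = inj₂ (inj₁ refl)
pigeonhole (inj₁ _)    (inj₂ refl) (inj₂ refl) = inj₂ (inj₂ refl)
pigeonhole (inj₂ _)    (inj₁ refl) (inj₁ refl) = inj₂ (inj₂ refl)

module Congruence (p : ℕ) .{{_ : NonZero p}} where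

  infix 4 _≈_ _≉_ _≈?_ _≈²_

  -- A record rather than a synonym for + p ∣ x - y, so that x and y can be recovered by
  -- unification (ℤ's _+_ and _*_ are not injective).
  record _≈_ (x y : ℤ) : Set where
    constructor congruent
    field p∣x-y : + p ∣ x - y
  open _≈_ public

  _≉_ : ℤ → ℤ → Set
  x ≉ y = ¬ x ≈ y

  _≈?_ : Decidable _≈_
  x ≈? y = map′ congruent p∣x-y (+ p ∣? x - y)

  private
    ∣-resp : ∀ a {b} → a ≡ b → + p ∣ a → + p ∣ b
    ∣-resp _ = subst (+ p ∣_)

  ≈-refl : ∀ {x} → x ≈ x
  ≈-refl {x} = congruent (∣-resp (+ 0) (solve (x ∷ [])) (divides (+ 0) refl))

  ≡⇒≈ : ∀ {x y} → x ≡ y → x ≈ y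
  ≡⇒≈ refl = ≈-refl

  ≈-sym : ∀ {x y} → x ≈ y → y ≈ x
  ≈-sym {x} {y} (congruent d) = congruent (∣-resp (- (x - y)) (solve (x ∷ y ∷ [])) (∣m⇒∣-m d))

  ≈-trans : ∀ {x y z} → x ≈ y → y ≈ z → x ≈ z
  ≈-trans {x} {y} {z} (congruent d) (congruent e) =
    congruent (∣-resp ((x - y) + (y - z)) (solve (x ∷ y ∷ z ∷ [])) (∣m∣n⇒∣m+n d e))

  ≈-setoid : Setoid _ _
  ≈-setoid = record
    { _≈_           = _≈_
    ; isEquivalence = record { refl = ≈-refl ; sym = ≈-sym ; trans = ≈-trans }
    }

  module ≈-Reasoning = Relation.Binary.Reasoning.Setoid ≈-setoid

  +-cong : ∀ {x x′ y y′} → x ≈ x′ → y ≈ y′ → x + y ≈ x′ + y′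
  +-cong {x} {x′} {y} {y′} (congruent d) (congruent e) =
    congruent (∣-resp ((x - x′) + (y - y′)) (solve (x ∷ x′ ∷ y ∷ y′ ∷ [])) (∣m∣n⇒∣m+n d e))

  -‿cong : ∀ {x y} → x ≈ y → - x ≈ - y
  -‿cong {x} {y} (congruent d) = congruent (∣-resp (- (x - y)) (solve (x ∷ y ∷ [])) (∣m⇒∣-m d))

  -cong : ∀ {x x′ y y′} → x ≈ x′ → y ≈ y′ → x - y ≈ x′ - y′
  -cong x≈x′ y≈y′ = +-cong x≈x′ (-‿cong y≈y′)

  *-cong : ∀ {x x′ y y′} → x ≈ x′ → y ≈ y′ → x * y ≈ x′ * y′
  *-cong {x} {x′} {y} {y′} (congruent d) (congruent e) =
    congruent (∣-resp (x * (y - y′) + (x - x′) * y′) (solve (x ∷ x′ ∷ y ∷ y′ ∷ []))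
      (∣m∣n⇒∣m+n (∣n⇒∣m*n x e) (∣m⇒∣m*n y′ d)))

  +-congˡ : ∀ x {y y′} → y ≈ y′ → x + y ≈ x + y′
  +-congˡ x = +-cong (≈-refl {x})

  +-congʳ : ∀ y {x x′} → x ≈ x′ → x + y ≈ x′ + y
  +-congʳ y x≈x′ = +-cong x≈x′ (≈-refl {y})

  *-congˡ : ∀ x {y y′} → y ≈ y′ → x * y ≈ x * y′
  *-congˡ x = *-cong (≈-refl {x})

  *-congʳ : ∀ y {x x′} → x ≈ x′ → x * y ≈ x′ * y
  *-congʳ y x≈x′ = *-cong x≈x′ (≈-refl {y})

  +-cancelʳ-≈ : ∀ {x y} w → x + w ≈ y + w → x ≈ y
  +-cancelʳ-≈ {x} {y} w (congruent d) =
    congruent (∣-resp ((x + w) - (y + w)) (solve (x ∷ y ∷ w ∷ [])) d)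

  ∣⇒≈0 : ∀ {x} → + p ∣ x → x ≈ + 0
  ∣⇒≈0 {x} = congruent ∘ subst (+ p ∣_) (sym (+-identityʳ x))

  ≈0⇒∣ : ∀ {x} → x ≈ + 0 → + p ∣ x
  ≈0⇒∣ {x} (congruent d) = subst (+ p ∣_) (+-identityʳ x) d

  ≈⇒-≈0 : ∀ {x y} → x ≈ y → x - y ≈ + 0
  ≈⇒-≈0 = ∣⇒≈0 ∘ p∣x-y

  -≈0⇒≈ : ∀ {x y} → x - y ≈ + 0 → x ≈ y
  -≈0⇒≈ = congruent ∘ ≈0⇒∣

  p≈0 : + p ≈ + 0
  p≈0 = ∣⇒≈0 ∣-refl

  ≈-residue : ∀ x → x ≈ + (x %ℕ p)
  ≈-residue x = begin
    x              ≡⟨ a≡a%ℕn+[a/ℕn]*n x p ⟩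
    r + q * + p    ≈⟨ +-congˡ r (*-congˡ q p≈0) ⟩
    r + q * + 0    ≡⟨ cong (_+_ r) (*-zeroʳ q) ⟩
    r + + 0        ≡⟨ +-identityʳ r ⟩
    r              ∎
    where
    open ≈-Reasoning
    r q : ℤ
    r = + (x %ℕ p)
    q = x /ℕ p

  private
    multiple-below-p : ∀ {n} → p ℕ.∣ n → n ℕ.< p → n ≡ 0
    multiple-below-p {zero}  _   _   = refl
    multiple-below-p {suc n} p∣n n<p = contradiction (ℕ.∣⇒≤ p∣n) (ℕ.<⇒≱ n<p)

    ≈-residues-≤ : ∀ {a b} → b ℕ.≤ a → a ℕ.< p → + a ≈ + b → a ≡ b
    ≈-residues-≤ {a} {b} b≤a a<p (congruent d) =
      ℕ.≤-antisym (ℕ.m∸n≡0⇒m≤n (multiple-below-p p∣a∸b (ℕ.≤-<-trans (ℕ.m∸n≤m a b) a<p))) b≤a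
      where
      p∣a∸b : p ℕ.∣ a ∸ b
      p∣a∸b = subst (p ℕ.∣_) (cong ∣_∣ (trans (m-n≡m⊖n a b) (⊖-≥ b≤a))) (∣⇒∣ᵤ d)

  ≈-residues : ∀ {a b} → a ℕ.< p → b ℕ.< p → + a ≈ + b → a ≡ b
  ≈-residues {a} {b} a<p b<p a≈b with ℕ.≤-total b a
  ... | inj₁ b≤a = ≈-residues-≤ b≤a a<p a≈b
  ... | inj₂ a≤b = sym (≈-residues-≤ a≤b b<p (≈-sym a≈b))

  Point : Set
  Point = ℤ × ℤ

  _≈²_ : Point → Point → Set
  u ≈² v = proj₁ u ≈ proj₁ v × proj₂ u ≈ proj₂ v

  record Translate (c : ℤ) (z o : Point) (a : ℤ) : Set where
    constructor translate
    field
      first  : proj₁ o ≈ proj₁ z + c * a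
      second : proj₂ o ≈ proj₂ z + c * (a * a)

  translate-resp-≈ : ∀ {c c′ z o a} → c ≈ c′ → Translate c z o a → Translate c′ z o a
  translate-resp-≈ {z = z} {a = a} c≈c′ (translate t₁ t₂) = translate
    (≈-trans t₁ (+-congˡ (proj₁ z) (*-congʳ a c≈c′)))
    (≈-trans t₂ (+-congˡ (proj₂ z) (*-congʳ (a * a) c≈c′)))

  translate-flip : ∀ {c z o a} → Translate c z o a → Translate (- c) o z a
  translate-flip {c} {a = a} (translate t₁ t₂) = translate (flip a t₁) (flip (a * a) t₂)
    where
    flip : ∀ {zₖ oₖ} A → oₖ ≈ zₖ + c * A → zₖ ≈ oₖ + - c * A
    flip {zₖ} {oₖ} A oₖ≈ = begin
      zₖ                     ≡⟨ solve (zₖ ∷ c ∷ A ∷ []) ⟩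
      (zₖ + c * A) + - c * A ≈⟨ +-congʳ (- c * A) (≈-sym oₖ≈) ⟩
      oₖ + - c * A           ∎
      where open ≈-Reasoning

  translates-common-base : ∀ {c z o o′ a a′}
    → Translate c z o a → Translate c z o′ a′ → a ≈ a′ → o ≈² o′
  translates-common-base {c} {z} (translate t₁ t₂) (translate t₁′ t₂′) a≈a′ =
    ≈-trans t₁ (≈-trans (+-congˡ (proj₁ z) (*-congˡ c a≈a′)) (≈-sym t₁′)) ,
    ≈-trans t₂ (≈-trans (+-congˡ (proj₂ z) (*-congˡ c (*-cong a≈a′ a≈a′))) (≈-sym t₂′))

  translates-common-target : ∀ {c z z′ o a a′}
    → Translate c z o a → Translate c z′ o a′ → a ≈ a′ → z ≈² z′
  translates-common-target {c} {z′ = z′} {a = a} {a′} (translate t₁ t₂) (translate t₁′ t₂′) a≈a′ =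
    +-cancelʳ-≈ (c * a) (≈-trans (≈-sym t₁) (≈-trans t₁′ (+-congˡ (proj₁ z′) (*-congˡ c a′≈a)))) ,
    +-cancelʳ-≈ (c * (a * a))
      (≈-trans (≈-sym t₂) (≈-trans t₂′ (+-congˡ (proj₂ z′) (*-congˡ c (*-cong a′≈a a′≈a)))))
    where
    a′≈a : a′ ≈ a
    a′≈a = ≈-sym a≈a′

  translate-displacement : ∀ {c z z′ o a a′} → Translate c z o a → Translate c z′ o a′
    → proj₁ z′ - proj₁ z ≈ c * (a - a′) × proj₂ z′ - proj₂ z ≈ c * (a * a - a′ * a′)
  translate-displacement {c} {z} {z′} {o} {a} {a′} (translate t₁ t₂) (translate t₁′ t₂′) =
    displacement (proj₁ z) (proj₁ z′) (proj₁ o) a a′ t₁ t₁′ ,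
    displacement (proj₂ z) (proj₂ z′) (proj₂ o) (a * a) (a′ * a′) t₂ t₂′
    where
    displacement : ∀ zₖ zₖ′ oₖ A A′ → oₖ ≈ zₖ + c * A → oₖ ≈ zₖ′ + c * A′ → zₖ′ - zₖ ≈ c * (A - A′)
    displacement zₖ zₖ′ oₖ A A′ oₖ≈ oₖ≈′ = begin
      zₖ′ - zₖ                                       ≡⟨ solve (c ∷ zₖ ∷ zₖ′ ∷ A ∷ A′ ∷ []) ⟩
      ((zₖ′ + c * A′) - (zₖ + c * A)) + c * (A - A′) ≈⟨ +-congʳ (c * (A - A′))
                                                          (-cong (≈-sym oₖ≈′) (≈-sym oₖ≈)) ⟩
      (oₖ - oₖ) + c * (A - A′)                       ≡⟨ solve (c ∷ oₖ ∷ A ∷ A′ ∷ []) ⟩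
      c * (A - A′)                                   ∎
      where open ≈-Reasoning

  record EqualChords (s a a′ t b b′ : ℤ) : Set where
    constructor equal-chords
    field
      linear    : s * (a - a′) ≈ t * (b - b′)
      quadratic : s * (a * a - a′ * a′) ≈ t * (b * b - b′ * b′)
  open EqualChords

  -- Both chords are the displacement from z to z′.
  translate-chords : ∀ {c d z z′ o o′ a a′ b b′}
    → Translate c z o a → Translate c z′ o a′ → Translate d z o′ b → Translate d z′ o′ b′
    → EqualChords c a a′ d b b′
  translate-chords s s′ t t′ = uncurry′ equal-chords
    (zip′ (≈-trans ∘ ≈-sym) (≈-trans ∘ ≈-sym) (translate-displacement s s′) (translate-displacement t t′))

  module _ (p-prime : Prime p) where

    zero-product : ∀ {x y} → x * y ≈ + 0 → x ≈ + 0 ⊎ y ≈ + 0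
    zero-product {x} {y} xy≈0 =
      map (∣⇒≈0 ∘ ∣ᵤ⇒∣) (∣⇒≈0 ∘ ∣ᵤ⇒∣)
        (euclidsLemma ∣ x ∣ ∣ y ∣ p-prime (subst (p ℕ.∣_) (abs-* x y) (∣⇒∣ᵤ (≈0⇒∣ xy≈0))))

    *-cancelˡ-≈ : ∀ {x y z} → x * y ≈ x * z → x ≈ + 0 ⊎ y ≈ z
    *-cancelˡ-≈ {x} {y} {z} xy≈xz = map₂ -≈0⇒≈ (zero-product x[y-z]≈0)
      where
      x[y-z]≈0 : x * (y - z) ≈ + 0
      x[y-z]≈0 = begin
        x * (y - z)    ≡⟨ solve (x ∷ y ∷ z ∷ []) ⟩
        x * y - x * z  ≈⟨ ≈⇒-≈0 xy≈xz ⟩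
        + 0            ∎
        where open ≈-Reasoning

    *-cancelˡ-nonzero : ∀ {x y z} → x ≉ + 0 → x * y ≈ x * z → y ≈ z
    *-cancelˡ-nonzero x≉0 = [ ⊥-elim ∘ x≉0 , id ] ∘ *-cancelˡ-≈

    private
      nonzero-residue-mod-2 : p ≡ 2 → ∀ {x} → x ≉ + 0 → x ≈ + 1
      nonzero-residue-mod-2 p≡2 {x} x≉0 with x %ℕ p | n%ℕd<d x p | ≈-residue x
      ... | 0           | _   | x≈0 = contradiction x≈0 x≉0
      ... | 1           | _   | x≈1 = x≈1
      ... | suc (suc r) | r<p | _   =
        contradiction (subst (suc (suc r) ℕ.<_) p≡2 r<p) (ℕ.≤⇒≯ (ℕ.m≤m+n 2 r))

      2≈0⇒p≡2 : + 2 ≈ + 0 → p ≡ 2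
      2≈0⇒p≡2 2≈0 = ℕ.≤-antisym (ℕ.∣⇒≤ (∣⇒∣ᵤ (≈0⇒∣ 2≈0)))
                                (nonTrivial⇒n>1 p {{prime⇒nonTrivial p-prime}})

    -- In characteristic 2 this holds because 1 is the only nonzero residue.
    double-injective : ∀ {x y} → x ≉ + 0 → y ≉ + 0 → x + x ≈ y + y → x ≈ y
    double-injective {x} {y} x≉0 y≉0 2x≈2y =
      [ characteristic-2 ∘ 2≈0⇒p≡2 , id ] (*-cancelˡ-≈ 2*x≈2*y)
      where
      characteristic-2 : p ≡ 2 → x ≈ y
      characteristic-2 p≡2 =
        ≈-trans (nonzero-residue-mod-2 p≡2 x≉0) (≈-sym (nonzero-residue-mod-2 p≡2 y≉0))
      2*x≈2*y : + 2 * x ≈ + 2 * y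
      2*x≈2*y = begin
        + 2 * x  ≡⟨ solve (x ∷ []) ⟩
        x + x    ≈⟨ 2x≈2y ⟩
        y + y    ≡⟨ solve (y ∷ []) ⟩
        + 2 * y  ∎
        where open ≈-Reasoning

    -- The secant of the parabola through a and a′ has direction (1 , a + a′).
    equal-chords⇒equal-sums : ∀ {s t a a′ b b′} → s ≉ + 0 → a ≉ a′
      → EqualChords s a a′ t b b′ → a + a′ ≈ b + b′
    equal-chords⇒equal-sums {s} {t} {a} {a′} {b} {b′} s≉0 a≉a′ (equal-chords lin quad) =
      [ ⊥-elim ∘ s[a-a′]≉0 , id ] (*-cancelˡ-≈ scaled)
      where
      s[a-a′]≉0 : s * (a - a′) ≉ + 0
      s[a-a′]≉0 = [ s≉0 , a≉a′ ∘ -≈0⇒≈ ] ∘ zero-product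
      scaled : s * (a - a′) * (a + a′) ≈ s * (a - a′) * (b + b′)
      scaled = begin
        s * (a - a′) * (a + a′)  ≡⟨ solve (s ∷ a ∷ a′ ∷ []) ⟩
        s * (a * a - a′ * a′)    ≈⟨ quad ⟩
        t * (b * b - b′ * b′)    ≡⟨ solve (t ∷ b ∷ b′ ∷ []) ⟩
        t * (b - b′) * (b + b′)  ≈⟨ *-congʳ (b + b′) (≈-sym lin) ⟩
        s * (a - a′) * (b + b′)  ∎
        where open ≈-Reasoning

    translate-C₄ : ∀ {c z₁ z₂ o₁ o₂ a a′ b b′} → c ≉ + 0 → a ≉ + 0 → b ≉ + 0
      → Translate c z₁ o₁ a → Translate c z₂ o₁ a′ → Translate c z₁ o₂ b → Translate c z₂ o₂ b′
      → z₁ ≈² z₂ ⊎ o₁ ≈² o₂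
    translate-C₄ {c} {a = a} {a′} {b} {b′} c≉0 a≉0 b≉0 s s′ t t′ with a ≈? a′
    ... | yes a≈a′ = inj₁ (translates-common-target s s′ a≈a′)
    ... | no  a≉a′ = inj₂ (translates-common-base s t a≈b)
      where
      chords : EqualChords c a a′ c b b′
      chords = translate-chords s s′ t t′
      sums : a + a′ ≈ b + b′
      sums = equal-chords⇒equal-sums c≉0 a≉a′ chords
      differences : a - a′ ≈ b - b′
      differences = *-cancelˡ-nonzero c≉0 (linear chords)
      a≈b : a ≈ b
      a≈b = double-injective a≉0 b≉0 (begin
        a + a                ≡⟨ solve (a ∷ a′ ∷ []) ⟩
        (a + a′) + (a - a′)  ≈⟨ +-cong sums differences ⟩
        (b + b′) + (b - b′)  ≡⟨ solve (b ∷ b′ ∷ []) ⟩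
        b + b                ∎)
        where open ≈-Reasoning

    -- (a₂ , b₂) and (a₃ , b₃) lie on the line a - b = b₁ - a₁ and on the line
    -- c₁ (a₁ - a) = c₂ (b₁ - b), which meet only once when c₁ ≉ c₂.
    equal-chords-unique : ∀ {c₁ c₂ a₁ a₂ a₃ b₁ b₂ b₃} → c₁ ≉ + 0 → c₁ ≉ c₂ → a₁ ≉ a₂ → a₁ ≉ a₃
      → EqualChords c₁ a₁ a₂ c₂ b₁ b₂ → EqualChords c₁ a₁ a₃ c₂ b₁ b₃ → a₂ ≈ a₃
    equal-chords-unique {c₁} {c₂} {a₁} {a₂} {a₃} {b₁} {b₂} {b₃} c₁≉0 c₁≉c₂ a₁≉a₂ a₁≉a₃ chords₂ chords₃ =
      [ -≈0⇒≈ {a₂} , ⊥-elim ∘ c₁≉c₂ ] (*-cancelˡ-≈ d*c₁≈d*c₂)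
      where
      open ≈-Reasoning
      d≈e : a₂ - a₃ ≈ b₂ - b₃
      d≈e = begin
        a₂ - a₃                ≡⟨ solve (a₁ ∷ a₂ ∷ a₃ ∷ []) ⟩
        (a₁ + a₂) - (a₁ + a₃)  ≈⟨ -cong (equal-chords⇒equal-sums c₁≉0 a₁≉a₂ chords₂)
                                        (equal-chords⇒equal-sums c₁≉0 a₁≉a₃ chords₃) ⟩
        (b₁ + b₂) - (b₁ + b₃)  ≡⟨ solve (b₁ ∷ b₂ ∷ b₃ ∷ []) ⟩
        b₂ - b₃                ∎
      d*c₁≈d*c₂ : (a₂ - a₃) * c₁ ≈ (a₂ - a₃) * c₂
      d*c₁≈d*c₂ = begin
        (a₂ - a₃) * c₁                   ≡⟨ solve (c₁ ∷ a₁ ∷ a₂ ∷ a₃ ∷ []) ⟩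
        c₁ * (a₁ - a₃) - c₁ * (a₁ - a₂)  ≈⟨ -cong (linear chords₃) (linear chords₂) ⟩
        c₂ * (b₁ - b₃) - c₂ * (b₁ - b₂)  ≡⟨ solve (c₂ ∷ b₁ ∷ b₂ ∷ b₃ ∷ []) ⟩
        (b₂ - b₃) * c₂                   ≈⟨ *-congʳ c₂ (≈-sym d≈e) ⟩
        (a₂ - a₃) * c₂                   ∎

    translate-K₂,₃ : ∀ {c₁ c₂ z₁ z₂ z₃ o₁ o₂ a₁ a₂ a₃ b₁ b₂ b₃} → c₁ ≉ + 0 → c₁ ≉ c₂
      → Translate c₁ z₁ o₁ a₁ → Translate c₁ z₂ o₁ a₂ → Translate c₁ z₃ o₁ a₃
      → Translate c₂ z₁ o₂ b₁ → Translate c₂ z₂ o₂ b₂ → Translate c₂ z₃ o₂ b₃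
      → z₁ ≈² z₂ ⊎ z₁ ≈² z₃ ⊎ z₂ ≈² z₃
    translate-K₂,₃ {a₁ = a₁} {a₂} {a₃} c₁≉0 c₁≉c₂ s₁ s₂ s₃ t₁ t₂ t₃ with a₁ ≈? a₂ | a₁ ≈? a₃
    ... | yes a₁≈a₂ | _         = inj₁ (translates-common-target s₁ s₂ a₁≈a₂)
    ... | no  _     | yes a₁≈a₃ = inj₂ (inj₁ (translates-common-target s₁ s₃ a₁≈a₃))
    ... | no  a₁≉a₂ | no  a₁≉a₃ = inj₂ (inj₂ (translates-common-target s₂ s₃ a₂≈a₃))
      where
      a₂≈a₃ : a₂ ≈ a₃
      a₂≈a₃ = equal-chords-unique c₁≉0 c₁≉c₂ a₁≉a₂ a₁≉a₃
        (translate-chords s₁ s₂ t₁ t₂) (translate-chords s₁ s₃ t₁ t₃)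

module Embedding (p : ℕ) .{{_ : NonZero p}} where
  open Field p
  open Congruence p

  ⟦_⟧ : F → ℤ
  ⟦ x ⟧ = + toℕ x

  ⟦_⟧² : F² → Point
  ⟦ x ⟧² = ⟦ proj₁ x ⟧ , ⟦ proj₂ x ⟧

  ⟦mod⟧ : ∀ n → ⟦ n mod p ⟧ ≈ + n
  ⟦mod⟧ n = ≈-sym (subst (+ n ≈_) (cong +_ (sym (toℕ-fromℕ< (m%n<n n p)))) (≈-residue (+ n)))

  ⟦0⟧ : ⟦ zeroF ⟧ ≈ + 0
  ⟦0⟧ = ⟦mod⟧ 0

  ⟦+⟧ : ∀ x y → ⟦ x +F y ⟧ ≈ ⟦ x ⟧ + ⟦ y ⟧
  ⟦+⟧ x y = ≈-trans (⟦mod⟧ _) (≡⇒≈ (pos-+ (toℕ x) (toℕ y)))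

  ⟦*⟧ : ∀ x y → ⟦ x *F y ⟧ ≈ ⟦ x ⟧ * ⟦ y ⟧
  ⟦*⟧ x y = ≈-trans (⟦mod⟧ _) (≡⇒≈ (pos-* (toℕ x) (toℕ y)))

  ⟦-⟧ : ∀ y x → ⟦ y -F x ⟧ ≈ ⟦ y ⟧ - ⟦ x ⟧
  ⟦-⟧ y x = begin
    ⟦ y -F x ⟧                      ≈⟨ ⟦mod⟧ _ ⟩
    + (toℕ y ℕ.+ (p ∸ toℕ x))      ≡⟨ pos-+ (toℕ y) (p ∸ toℕ x) ⟩
    ⟦ y ⟧ + + (p ∸ toℕ x)          ≡⟨ cong (_+_ ⟦ y ⟧) (sym (trans (m-n≡m⊖n p (toℕ x)) (⊖-≥ (ℕ.<⇒≤ (toℕ<n x))))) ⟩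
    ⟦ y ⟧ + (+ p - ⟦ x ⟧)          ≈⟨ +-congˡ ⟦ y ⟧ (-cong p≈0 (≈-refl {⟦ x ⟧})) ⟩
    ⟦ y ⟧ + (+ 0 - ⟦ x ⟧)          ≡⟨ cong (_+_ ⟦ y ⟧) (+-identityˡ (- ⟦ x ⟧)) ⟩
    ⟦ y ⟧ - ⟦ x ⟧                  ∎
    where open ≈-Reasoning

  ⟦⟧-injective : ∀ {x y} → ⟦ x ⟧ ≈ ⟦ y ⟧ → x ≡ y
  ⟦⟧-injective {x} {y} = toℕ-injective ∘ ≈-residues (toℕ<n x) (toℕ<n y)

  ⟦⟧²-injective : ∀ {x y} → ⟦ x ⟧² ≈² ⟦ y ⟧² → x ≡ y
  ⟦⟧²-injective (x₁≈y₁ , x₂≈y₂) = cong₂ _,_ (⟦⟧-injective x₁≈y₁) (⟦⟧-injective x₂≈y₂)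

  ⟦⟧-nonzero : ∀ {a} → a ≢ zeroF → ⟦ a ⟧ ≉ + 0
  ⟦⟧-nonzero a≢0 a≈0 = a≢0 (⟦⟧-injective (≈-trans a≈0 (≈-sym ⟦0⟧)))

  ⟦step⟧ : ∀ c x a → Translate ⟦ c ⟧ ⟦ x ⟧² ⟦ x +² (c ·² par a) ⟧² ⟦ a ⟧
  ⟦step⟧ c (x₁ , x₂) a = translate
    (≈-trans (⟦+⟧ x₁ (c *F a)) (+-congˡ ⟦ x₁ ⟧ (⟦*⟧ c a)))
    (≈-trans (⟦+⟧ x₂ (c *F (a *F a))) (+-congˡ ⟦ x₂ ⟧ (≈-trans (⟦*⟧ c (a *F a)) (*-congˡ ⟦ c ⟧ (⟦*⟧ a a)))))

module Spokes (p : ℕ) .{{_ : NonZero p}} (p-prime : Prime p) (m : ℕ) (λ′ : Fin m → Field.F p)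
              (λ′-injective : Injective _≡_ _≡_ λ′) (h i j : Fin m) (h≢i : h ≢ i) (j≢i : j ≢ i) where
  open Field p
  open Construction p m λ′
  open Congruence p
  open Embedding p

  layer : Vertex → Fin m
  layer = proj₂

  position : Vertex → Point
  position v = ⟦ proj₁ v ⟧²

  slope : Fin m → ℤ
  slope k = ⟦ λ′ k ⟧ - ⟦ λ′ i ⟧

  slope-injective : ∀ {k l} → slope k ≈ slope l → k ≡ l
  slope-injective {k} {l} = λ′-injective ∘ ⟦⟧-injective ∘ +-cancelʳ-≈ (- ⟦ λ′ i ⟧)

  slope-nonzero : ∀ {k} → k ≢ i → slope k ≉ + 0
  slope-nonzero k≢i k≈0 = k≢i (slope-injective (≈-trans k≈0 (≈-sym (≈⇒-≈0 (≈-refl {⟦ λ′ i ⟧})))))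

  -lam≈slope : ∀ k → - ⟦ lam k i ⟧ ≈ slope k
  -lam≈slope k = ≈-trans (-‿cong (⟦-⟧ (λ′ i) (λ′ k))) (≡⇒≈ (neg-difference ⟦ λ′ i ⟧ ⟦ λ′ k ⟧))
    where
    neg-difference : ∀ x y → - (x - y) ≡ y - x
    neg-difference x y = solve (x ∷ y ∷ [])

  -- An edge of G(hij), listed with its endpoint in Xᵢ first.
  record Spoke (z o : Vertex) : Set where
    field
      centre : layer z ≡ i
      outer  : layer o ≡ h ⊎ layer o ≡ j
      a      : F
      a≢0    : a ≢ zeroF
      offset : Translate (slope (layer o)) (position z) (position o) ⟦ a ⟧
  open Spoke

  outer≢centre : ∀ {z o} → Spoke z o → layer o ≢ i
  outer≢centre s o≡i with outer s
  ... | inj₁ o≡h = h≢i (trans (sym o≡h) o≡i)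
  ... | inj₂ o≡j = j≢i (trans (sym o≡j) o≡i)

  edge⇒spoke : ∀ {u v} → G₃ h i j u v → Spoke u v ⊎ Spoke v u
  edge⇒spoke {x , _} (inj₁ (inj₁ (refl , refl , a , a≢0 , refl))) =
    inj₂ (record { centre = refl ; outer = inj₁ refl ; a = a ; a≢0 = a≢0
                 ; offset = translate-resp-≈ (-lam≈slope h) (translate-flip (⟦step⟧ (lam h i) x a)) })
  edge⇒spoke {_ , _} {y , _} (inj₁ (inj₂ (refl , refl , a , a≢0 , refl))) =
    inj₁ (record { centre = refl ; outer = inj₁ refl ; a = a ; a≢0 = a≢0
                 ; offset = translate-resp-≈ (-lam≈slope h) (translate-flip (⟦step⟧ (lam h i) y a)) })
  edge⇒spoke {x , _} (inj₂ (inj₁ (refl , refl , a , a≢0 , refl))) =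
    inj₁ (record { centre = refl ; outer = inj₂ refl ; a = a ; a≢0 = a≢0
                 ; offset = translate-resp-≈ (⟦-⟧ (λ′ j) (λ′ i)) (⟦step⟧ (lam i j) x a) })
  edge⇒spoke {_ , _} {y , _} (inj₂ (inj₂ (refl , refl , a , a≢0 , refl))) =
    inj₂ (record { centre = refl ; outer = inj₂ refl ; a = a ; a≢0 = a≢0
                 ; offset = translate-resp-≈ (⟦-⟧ (λ′ j) (λ′ i)) (⟦step⟧ (lam i j) y a) })

  G-sym : ∀ {k l u v} → G k l u v → G k l v u
  G-sym (inj₁ (u∈Xₖ , v∈Xₗ , step)) = inj₂ (v∈Xₗ , u∈Xₖ , step)
  G-sym (inj₂ (u∈Xₗ , v∈Xₖ , step)) = inj₁ (v∈Xₖ , u∈Xₗ , step)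

  G₃-sym : ∀ {u v} → G₃ h i j u v → G₃ h i j v u
  G₃-sym = map G-sym G-sym

  spoke-from-centre : ∀ {u v} → G₃ h i j u v → layer u ≡ i → Spoke u v
  spoke-from-centre e u∈Xᵢ with edge⇒spoke e
  ... | inj₁ s = s
  ... | inj₂ s = contradiction u∈Xᵢ (outer≢centre s)

  spoke-to-outer : ∀ {u v} → G₃ h i j u v → layer v ≢ i → Spoke u v
  spoke-to-outer e v∉Xᵢ with edge⇒spoke e
  ... | inj₁ s = s
  ... | inj₂ s = contradiction (centre s) v∉Xᵢ

  vertex-≡ : ∀ {u v} → layer u ≡ layer v → position u ≈² position v → u ≡ v
  vertex-≡ refl u≈v = cong (_, _) (⟦⟧²-injective u≈v)

  spoke-C₄ : ∀ {z₁ z₂ o₁ o₂} → Spoke z₁ o₁ → Spoke z₂ o₁ → Spoke z₁ o₂ → Spoke z₂ o₂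
    → layer o₁ ≡ layer o₂ → z₁ ≡ z₂ ⊎ o₁ ≡ o₂
  spoke-C₄ {o₁ = o₁} {o₂ = o₂} s₁₁ s₂₁ s₁₂ s₂₂ o₁~o₂ =
    map (vertex-≡ (trans (centre s₁₁) (sym (centre s₂₁)))) (vertex-≡ o₁~o₂)
      (translate-C₄ p-prime (slope-nonzero (outer≢centre s₁₁)) (⟦⟧-nonzero (a≢0 s₁₁)) (⟦⟧-nonzero (a≢0 s₁₂))
        (offset s₁₁) (offset s₂₁) (same-slope (offset s₁₂)) (same-slope (offset s₂₂)))
    where
    same-slope : ∀ {z o A} → Translate (slope (layer o₂)) z o A → Translate (slope (layer o₁)) z o A
    same-slope = translate-resp-≈ (≡⇒≈ (cong slope (sym o₁~o₂)))

  spoke-K₂,₃ : ∀ {z₁ z₂ z₃ o₁ o₂} → Spoke z₁ o₁ → Spoke z₂ o₁ → Spoke z₃ o₁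
    → Spoke z₁ o₂ → Spoke z₂ o₂ → Spoke z₃ o₂ → layer o₁ ≢ layer o₂
    → z₁ ≡ z₂ ⊎ z₁ ≡ z₃ ⊎ z₂ ≡ z₃
  spoke-K₂,₃ s₁ s₂ s₃ t₁ t₂ t₃ o₁≁o₂ =
    map (vertex-≡ (layers s₁ s₂)) (map (vertex-≡ (layers s₁ s₃)) (vertex-≡ (layers s₂ s₃)))
      (translate-K₂,₃ p-prime (slope-nonzero (outer≢centre s₁)) (o₁≁o₂ ∘ slope-injective)
        (offset s₁) (offset s₂) (offset s₃) (offset t₁) (offset t₂) (offset t₃))
    where
    layers : ∀ {z z′ o} → Spoke z o → Spoke z′ o → layer z ≡ layer z′
    layers s s′ = trans (centre s) (sym (centre s′))

  pair-in-Xᵢ-no-K₂,₃ : ∀ {u₁ u₂ w₁ w₂ w₃} → u₁ ≢ u₂ → w₁ ≢ w₂ → w₁ ≢ w₃ → w₂ ≢ w₃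
    → Spoke u₁ w₁ → Spoke u₁ w₂ → Spoke u₁ w₃ → Spoke u₂ w₁ → Spoke u₂ w₂ → Spoke u₂ w₃ → ⊥
  pair-in-Xᵢ-no-K₂,₃ {u₁} {u₂} u₁≢u₂ w₁≢w₂ w₁≢w₃ w₂≢w₃ s₁₁ s₁₂ s₁₃ s₂₁ s₂₂ s₂₃ =
    [ C₄ s₁₁ s₁₂ s₂₁ s₂₂ w₁≢w₂ , [ C₄ s₁₁ s₁₃ s₂₁ s₂₃ w₁≢w₃ , C₄ s₁₂ s₁₃ s₂₂ s₂₃ w₂≢w₃ ] ]
      (pigeonhole (outer s₁₁) (outer s₁₂) (outer s₁₃))
    where
    C₄ : ∀ {w w′} → Spoke u₁ w → Spoke u₁ w′ → Spoke u₂ w → Spoke u₂ w′ → w ≢ w′ → layer w ≡ layer w′ → ⊥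
    C₄ s₁ s₁′ s₂ s₂′ w≢w′ w~w′ = [ u₁≢u₂ , w≢w′ ] (spoke-C₄ s₁ s₂ s₁′ s₂′ w~w′)

  triple-in-Xᵢ-no-K₂,₃ : ∀ {u₁ u₂ w₁ w₂ w₃} → u₁ ≢ u₂ → w₁ ≢ w₂ → w₁ ≢ w₃ → w₂ ≢ w₃
    → Spoke w₁ u₁ → Spoke w₂ u₁ → Spoke w₃ u₁ → Spoke w₁ u₂ → Spoke w₂ u₂ → Spoke w₃ u₂ → ⊥
  triple-in-Xᵢ-no-K₂,₃ {u₁} {u₂} u₁≢u₂ w₁≢w₂ w₁≢w₃ w₂≢w₃ t₁₁ t₂₁ t₃₁ t₁₂ t₂₂ t₃₂ with layer u₁ ≟ layer u₂
  ... | yes u₁~u₂ = [ w₁≢w₂ , u₁≢u₂ ] (spoke-C₄ t₁₁ t₂₁ t₁₂ t₂₂ u₁~u₂)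
  ... | no  u₁≁u₂ = [ w₁≢w₂ , [ w₁≢w₃ , w₂≢w₃ ] ] (spoke-K₂,₃ t₁₁ t₂₁ t₃₁ t₁₂ t₂₂ t₃₂ u₁≁u₂)

  no-K₂,₃ : ¬ ContainsK23 (G₃ h i j)
  no-K₂,₃ (u₁ , u₂ , w₁ , w₂ , w₃ , (u₁≢u₂ , _ , _ , _ , _ , _ , _ , w₁≢w₂ , w₁≢w₃ , w₂≢w₃)
                                 , (e₁₁ , e₁₂ , e₁₃ , e₂₁ , e₂₂ , e₂₃))
    with layer u₁ ≟ i
  ... | yes u₁∈Xᵢ = pair-in-Xᵢ-no-K₂,₃ u₁≢u₂ w₁≢w₂ w₁≢w₃ w₂≢w₃ s₁₁ s₁₂ s₁₃
    (spoke-to-outer e₂₁ (outer≢centre s₁₁))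
    (spoke-to-outer e₂₂ (outer≢centre s₁₂))
    (spoke-to-outer e₂₃ (outer≢centre s₁₃))
    where
    s₁₁ : Spoke u₁ w₁
    s₁₂ : Spoke u₁ w₂
    s₁₃ : Spoke u₁ w₃
    s₁₁ = spoke-from-centre e₁₁ u₁∈Xᵢ
    s₁₂ = spoke-from-centre e₁₂ u₁∈Xᵢ
    s₁₃ = spoke-from-centre e₁₃ u₁∈Xᵢ
  ... | no u₁∉Xᵢ = triple-in-Xᵢ-no-K₂,₃ u₁≢u₂ w₁≢w₂ w₁≢w₃ w₂≢w₃ t₁₁ t₂₁ t₃₁
    (spoke-from-centre (G₃-sym e₂₁) (centre t₁₁))
    (spoke-from-centre (G₃-sym e₂₂) (centre t₂₁))
    (spoke-from-centre (G₃-sym e₂₃) (centre t₃₁))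
    where
    t₁₁ : Spoke w₁ u₁
    t₂₁ : Spoke w₂ u₁
    t₃₁ : Spoke w₃ u₁
    t₁₁ = spoke-to-outer (G₃-sym e₁₁) u₁∉Xᵢ
    t₂₁ = spoke-to-outer (G₃-sym e₁₂) u₁∉Xᵢ
    t₃₁ = spoke-to-outer (G₃-sym e₁₃) u₁∉Xᵢ

lemma3 : (p : ℕ) .{{_ : NonZero p}} → Prime p → (m : ℕ) → (H : Graph m)
    → (λ′ : Fin m → Field.F p) → Injective _≡_ _≡_ λ′
    → (h i j : Fin m) → Graph.Adj H h i → Graph.Adj H i j → h ≢ j
    → ¬ ContainsK23 (Construction.G₃ p m λ′ h i j)
lemma3 p p-prime m H λ′ λ′-injective h i j h~i i~j _ =
  Spokes.no-K₂,₃ p p-prime m λ′ λ′-injective h i j (adjacent⇒≢ h~i) (adjacent⇒≢ (Graph.symm H i~j))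
  where
  adjacent⇒≢ : ∀ {k l} → Graph.Adj H k l → k ≢ l
  adjacent⇒≢ k~l refl = Graph.irrefl H k~l
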